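{- Let $Q$ be a quadrilateral in standard form with coefficient $\mu$, over a field $\mathbb{k}$ of characteristic $\neq2$. Then $\Phi_Q(X,Y)=Y^2-\mu X^2$. Moreover, two lines $\ell,\ell'$, neither parallel to the $X$-axis nor to the $Y$-axis, are $Q$-orthogonal if and only if the product of their slopes is $\mu$.
   Context: Every line $L$ has an equation $tX-uY+v=0$ normalized so that $t=1$ if $u=0$ and $u=1$ if $u\ne0$; write $t_L,u_L,v_L$. A quadrilateral $Q=ABA'B'$: four distinct lines, not all concurrent, adjacent sides ($\{A,B\},\{B,A'\},\{A',B'\},\{B',A\}$) not parallel. $Q$ is in standard form if $A$ is $Y=0$ and $A'$ is $X=0$; then $B,B'$ have slopes $t_B,t_{B'}$ and the coefficient is $\mu=t_Bt_{B'}$. $\alpha = t_Au_Bu_{A'}u_{B'} - u_At_Bu_{A'}u_{B'} + u_Au_Bt_{A'}u_{B'} - u_Au_Bu_{A'}t_{B'}$, $\beta = t_Au_Bt_{A'}u_{B'}-u_At_Bu_{A'}t_{B'}$, $\gamma = t_At_Bt_{A'}u_{B'}-t_At_Bu_{A'}t_{B'}+t_Au_Bt_{A'}t_{B'}-u_At_Bt_{A'}t_{B'}$; $\Phi_Q(X,Y)=\gamma X^2-2\beta XY+\alpha Y^2$; $\langle \mathbf v,\mathbf w\rangle_Q=\mathbf v^T\begin{pmatrix}\gamma&-\beta\\-\beta&\alpha\end{pmatrix}\mathbf w$. Lines $\ell_1,\ell_2$ are $Q$-orthogonal if $\langle (u_{\ell_1},t_{\ell_1}),(u_{\ell_2},t_{\ell_2})\rangle_Q=0$.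 -}

module Defs where

open import Level using (_⊔_; suc)
open import Algebra.Bundles using (CommutativeRing)
open import Data.Product using (Σ; ∃; _×_; _,_)
open import Data.Sum using (_⊎_; inj₁; inj₂)
open import Relation.Nullary using (¬_)

record Field (c ℓ : Level.Level) : Set (suc (c ⊔ ℓ)) where
  field
    commutativeRing : CommutativeRing c ℓ
  open CommutativeRing commutativeRing public
  field
    1≉0 : ¬ (1# ≈ 0#)
    inverse : ∀ x → ¬ (x ≈ 0#) → ∃ λ y → x * y ≈ 1#

module FieldDefs {c ℓ} (F : Field c ℓ) where
  open Field F

  CharNot2 : Set ℓ
  CharNot2 = ¬ ((1# + 1#) ≈ 0#)

  -- A line  t X - u Y + v = 0 , normalized: t = 1 if u = 0, and u = 1 if u ≠ 0.
  record Line : Set (c ⊔ ℓ) where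
    constructor mkLine
    field
      t u v : Carrier
      normalized : ((u ≈ 0#) × (t ≈ 1#)) ⊎ (u ≈ 1#)
  open Line public

  SameLine : Line → Line → Set ℓ
  SameLine L M = (t L ≈ t M) × (u L ≈ u M) × (v L ≈ v M)

  OnLine : Carrier → Carrier → Line → Set ℓ
  OnLine x y L = ((t L * x) - (u L * y)) + v L ≈ 0#

  -- parallel: the direction vectors (u , t) are proportional
  Parallel : Line → Line → Set ℓ
  Parallel L M = (t L * u M) - (u L * t M) ≈ 0#

  record Quadrilateral : Set (c ⊔ ℓ) where
    field
      A B A′ B′ : Line
      dAB   : ¬ SameLine A B
      dAA′  : ¬ SameLine A A′
      dAB′  : ¬ SameLine A B′
      dBA′  : ¬ SameLine B A′
      dBB′  : ¬ SameLine B B′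
      dA′B′ : ¬ SameLine A′ B′
      notConcurrent : ¬ (Σ Carrier λ x → Σ Carrier λ y →
                          OnLine x y A × OnLine x y B × OnLine x y A′ × OnLine x y B′)
      npAB   : ¬ Parallel A B
      npBA′  : ¬ Parallel B A′
      npA′B′ : ¬ Parallel A′ B′
      npB′A  : ¬ Parallel B′ A
  open Quadrilateral public

  -- Standard form: A is  Y = 0  (t,u,v) = (0,1,0) and A′ is  X = 0  (t,u,v) = (1,0,0).
  StandardForm : Quadrilateral → Set ℓ
  StandardForm Q = ((t (A Q) ≈ 0#) × (u (A Q) ≈ 1#) × (v (A Q) ≈ 0#))
                 × ((t (A′ Q) ≈ 1#) × (u (A′ Q) ≈ 0#) × (v (A′ Q) ≈ 0#))

  -- slope of a non-vertical line (u = 1):  Y = t X + v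
  slope : Line → Carrier
  slope L = t L

  μ : Quadrilateral → Carrier
  μ Q = slope (B Q) * slope (B′ Q)

  module _ (Q : Quadrilateral) where
    private
      tA = t (A Q) ; uA = u (A Q) ; tB = t (B Q) ; uB = u (B Q)
      tA′ = t (A′ Q) ; uA′ = u (A′ Q) ; tB′ = t (B′ Q) ; uB′ = u (B′ Q)

    αQ : Carrier
    αQ = (((tA * uB * uA′ * uB′) - (uA * tB * uA′ * uB′)) + (uA * uB * tA′ * uB′))
           - (uA * uB * uA′ * tB′)

    βQ : Carrier
    βQ = (tA * uB * tA′ * uB′) - (uA * tB * uA′ * tB′)

    γQ : Carrier
    γQ = (((tA * tB * tA′ * uB′) - (tA * tB * uA′ * tB′)) + (tA * uB * tA′ * tB′))
           - (uA * tB * tA′ * tB′)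

    -- Φ_Q(X,Y) = γ X² - 2β XY + α Y², as its coefficient triple (X², XY, Y²)
    Φ : Carrier × Carrier × Carrier
    Φ = γQ , - (βQ + βQ) , αQ

    inner : Carrier × Carrier → Carrier × Carrier → Carrier
    inner (v₁ , v₂) (w₁ , w₂) =
      (v₁ * ((γQ * w₁) + ((- βQ) * w₂))) + (v₂ * (((- βQ) * w₁) + (αQ * w₂)))

    Orthogonal : Line → Line → Set ℓ
    Orthogonal L M = inner (u L , t L) (u M , t M) ≈ 0#

  _≈Φ_ : Carrier × Carrier × Carrier → Carrier × Carrier × Carrier → Set ℓ
  (a , b , c′) ≈Φ (a′ , b′ , c″) = (a ≈ a′) × (b ≈ b′) × (c′ ≈ c″)

  Y²-mX² : Carrier → Carrier × Carrier × Carrier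
  Y²-mX² m = - m , 0# , 1#

  X-axis : Line
  X-axis = mkLine 0# 1# 0# (inj₂ refl)

  Y-axis : Line
  Y-axis = mkLine 1# 0# 0# (inj₁ (refl , refl))

{-# OPTIONS --safe #-}
module Submission where

-- In standard form A has direction (u, t) = (1, 0) and A′ has (0, 1), so every monomial of
-- α, β, γ containing t_A or u_A′ vanishes. Since B and B′ are not parallel to A′ they are not
-- vertical, so u_B = u_B′ = 1 and only α = u_A u_B t_A′ u_B′ = 1 and γ = - u_A t_B t_A′ t_B′ = - μ
-- survive, with β = 0. For non-vertical lines ℓ, ℓ′ the form is then ⟨ℓ, ℓ′⟩_Q = - μ + t_ℓ t_ℓ′.

open import Defs
open import Algebra.Bundles using (CommutativeRing)
open import Data.Product using (_×_; _,_)
open import Data.Sum using (inj₁; inj₂)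
open import Data.Empty using (⊥-elim)
open import Relation.Nullary using (¬_)
open import Function.Bundles using (_⇔_; mk⇔; module Equivalence)
import Algebra.Properties.Ring as RingProperties
import Relation.Binary.Reasoning.Setoid as SetoidReasoning

module CommutativeRingLemmas {c ℓ} (R : CommutativeRing c ℓ) where
  open CommutativeRing R
  open RingProperties ring using (-0#≈0#; x∙y⁻¹≈ε⇒x≈y; x≈y⇒x∙y⁻¹≈ε)

  x≈0⇒x*y≈0 : ∀ {x} y → x ≈ 0# → x * y ≈ 0#
  x≈0⇒x*y≈0 y x≈0 = trans (*-congʳ x≈0) (zeroˡ y)

  y≈0⇒x*y≈0 : ∀ x {y} → y ≈ 0# → x * y ≈ 0#
  y≈0⇒x*y≈0 x y≈0 = trans (*-congˡ y≈0) (zeroʳ x)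

  x≈1⇒x*y≈y : ∀ {x} y → x ≈ 1# → x * y ≈ y
  x≈1⇒x*y≈y y x≈1 = trans (*-congʳ x≈1) (*-identityˡ y)

  y≈1⇒x*y≈x : ∀ x {y} → y ≈ 1# → x * y ≈ x
  y≈1⇒x*y≈x x y≈1 = trans (*-congˡ y≈1) (*-identityʳ x)

  x≈0⇒x+y≈y : ∀ {x} y → x ≈ 0# → x + y ≈ y
  x≈0⇒x+y≈y y x≈0 = trans (+-congʳ x≈0) (+-identityˡ y)

  y≈0⇒x+y≈x : ∀ x {y} → y ≈ 0# → x + y ≈ x
  y≈0⇒x+y≈x x y≈0 = trans (+-congˡ y≈0) (+-identityʳ x)

  x≈0⇒-x≈0 : ∀ {x} → x ≈ 0# → - x ≈ 0#
  x≈0⇒-x≈0 x≈0 = trans (-‿cong x≈0) -0#≈0#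

  x≈0∧y≈0⇒x-y≈0 : ∀ {x y} → x ≈ 0# → y ≈ 0# → x - y ≈ 0#
  x≈0∧y≈0⇒x-y≈0 x≈0 y≈0 = trans (x≈0⇒x+y≈y _ x≈0) (x≈0⇒-x≈0 y≈0)

  -y+x≈0⇔x≈y : ∀ x y → (- y + x ≈ 0#) ⇔ (x ≈ y)
  -y+x≈0⇔x≈y x y = mk⇔ (λ eq → x∙y⁻¹≈ε⇒x≈y x y (trans (+-comm x (- y)) eq))
                       (λ eq → trans (+-comm (- y) x) (x≈y⇒x∙y⁻¹≈ε eq))

  first≈0⇒monomial≈0 : ∀ {a} b c d → a ≈ 0# → a * b * c * d ≈ 0#
  first≈0⇒monomial≈0 b c d a≈0 = x≈0⇒x*y≈0 d (x≈0⇒x*y≈0 c (x≈0⇒x*y≈0 b a≈0))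

  third≈0⇒monomial≈0 : ∀ a b {c} d → c ≈ 0# → a * b * c * d ≈ 0#
  third≈0⇒monomial≈0 a b d c≈0 = x≈0⇒x*y≈0 d (y≈0⇒x*y≈0 (a * b) c≈0)

  first≈1∧third≈1⇒monomial≈bd : ∀ {a} b {c} d → a ≈ 1# → c ≈ 1# → a * b * c * d ≈ b * d
  first≈1∧third≈1⇒monomial≈bd b d a≈1 c≈1 =
    *-congʳ (trans (y≈1⇒x*y≈x _ c≈1) (x≈1⇒x*y≈y b a≈1))

module QuadrilateralLemmas {c ℓ} (F : Field c ℓ) where
  open Field F
  open FieldDefs F
  open CommutativeRingLemmas commutativeRing
  open SetoidReasoning setoid

  vertical-parallel : ∀ L M → u L ≈ 0# → u M ≈ 0# → Parallel L M
  vertical-parallel L M uL≈0 uM≈0 =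
    x≈0∧y≈0⇒x-y≈0 (y≈0⇒x*y≈0 (t L) uM≈0) (x≈0⇒x*y≈0 (t M) uL≈0)

  non-vertical⇒u≈1 : ∀ L → ¬ (u L ≈ 0#) → u L ≈ 1#
  non-vertical⇒u≈1 (mkLine _ _ _ (inj₁ (u≈0 , _))) u≉0 = ⊥-elim (u≉0 u≈0)
  non-vertical⇒u≈1 (mkLine _ _ _ (inj₂ u≈1))       _   = u≈1

  ¬Parallel-Y-axis⇒u≈1 : ∀ L → ¬ Parallel L Y-axis → u L ≈ 1#
  ¬Parallel-Y-axis⇒u≈1 L ∦Y = non-vertical⇒u≈1 L (λ uL≈0 → ∦Y (vertical-parallel L Y-axis uL≈0 refl))

  module InStandardForm (Q : Quadrilateral)
      (tA≈0 : t (A Q) ≈ 0#) (uA≈1 : u (A Q) ≈ 1#) (tA′≈1 : t (A′ Q) ≈ 1#) (uA′≈0 : u (A′ Q) ≈ 0#)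
      where

    uB≈1 : u (B Q) ≈ 1#
    uB≈1 = non-vertical⇒u≈1 (B Q) λ uB≈0 → npBA′ Q (vertical-parallel (B Q) (A′ Q) uB≈0 uA′≈0)

    uB′≈1 : u (B′ Q) ≈ 1#
    uB′≈1 = non-vertical⇒u≈1 (B′ Q) λ uB′≈0 → npA′B′ Q (vertical-parallel (A′ Q) (B′ Q) uA′≈0 uB′≈0)

    α≈1 : αQ Q ≈ 1#
    α≈1 = begin
      αQ Q                                    ≈⟨ y≈0⇒x+y≈x _ (x≈0⇒-x≈0 (third≈0⇒monomial≈0 _ _ _ uA′≈0)) ⟩
      _ + u (A Q) * u (B Q) * t (A′ Q) * u (B′ Q)
        ≈⟨ x≈0⇒x+y≈y _ (x≈0∧y≈0⇒x-y≈0 (first≈0⇒monomial≈0 _ _ _ tA≈0) (third≈0⇒monomial≈0 _ _ _ uA′≈0)) ⟩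
      u (A Q) * u (B Q) * t (A′ Q) * u (B′ Q) ≈⟨ first≈1∧third≈1⇒monomial≈bd _ _ uA≈1 tA′≈1 ⟩
      u (B Q) * u (B′ Q)                      ≈⟨ x≈1⇒x*y≈y _ uB≈1 ⟩
      u (B′ Q)                                ≈⟨ uB′≈1 ⟩
      1#                                      ∎

    β≈0 : βQ Q ≈ 0#
    β≈0 = x≈0∧y≈0⇒x-y≈0 (first≈0⇒monomial≈0 _ _ _ tA≈0) (third≈0⇒monomial≈0 _ _ _ uA′≈0)

    γ≈-μ : γQ Q ≈ - μ Q
    γ≈-μ = begin
      γQ Q                                         ≈⟨ x≈0⇒x+y≈y _ first-three-terms≈0 ⟩
      - (u (A Q) * t (B Q) * t (A′ Q) * t (B′ Q))  ≈⟨ -‿cong (first≈1∧third≈1⇒monomial≈bd _ _ uA≈1 tA′≈1) ⟩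
      - μ Q                                        ∎
      where
      tA⋯≈0 : ∀ b c d → t (A Q) * b * c * d ≈ 0#
      tA⋯≈0 b c d = first≈0⇒monomial≈0 b c d tA≈0
      first-three-terms≈0 : (t (A Q) * t (B Q) * t (A′ Q) * u (B′ Q) - t (A Q) * t (B Q) * u (A′ Q) * t (B′ Q))
                              + t (A Q) * u (B Q) * t (A′ Q) * t (B′ Q) ≈ 0#
      first-three-terms≈0 = trans (x≈0⇒x+y≈y _ (x≈0∧y≈0⇒x-y≈0 (tA⋯≈0 _ _ _) (tA⋯≈0 _ _ _))) (tA⋯≈0 _ _ _)

    Φ≈Y²-μX² : Φ Q ≈Φ Y²-mX² (μ Q)
    Φ≈Y²-μX² = γ≈-μ , x≈0⇒-x≈0 (trans (+-cong β≈0 β≈0) (+-identityʳ 0#)) , α≈1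

    inner-non-vertical : ∀ L L′ → u L ≈ 1# → u L′ ≈ 1# →
                         inner Q (u L , t L) (u L′ , t L′) ≈ - μ Q + t L * t L′
    inner-non-vertical L L′ uL≈1 uL′≈1 = begin
      inner Q (u L , t L) (u L′ , t L′)
        ≈⟨ +-cong (x≈1⇒x*y≈y _ uL≈1) (*-congˡ (x≈0⇒x+y≈y _ (x≈0⇒x*y≈0 _ -β≈0))) ⟩
      γQ Q * u L′ + - βQ Q * t L′ + t L * (αQ Q * t L′)
        ≈⟨ +-cong (y≈0⇒x+y≈x _ (x≈0⇒x*y≈0 _ -β≈0)) (*-congˡ (x≈1⇒x*y≈y _ α≈1)) ⟩
      γQ Q * u L′ + t L * t L′
        ≈⟨ +-congʳ (trans (y≈1⇒x*y≈x _ uL′≈1) γ≈-μ) ⟩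
      - μ Q + t L * t L′ ∎
      where
      -β≈0 : - βQ Q ≈ 0#
      -β≈0 = x≈0⇒-x≈0 β≈0

    orthogonal⇔slopes : ∀ L L′ → ¬ Parallel L Y-axis → ¬ Parallel L′ Y-axis →
                        Orthogonal Q L L′ ⇔ (slope L * slope L′ ≈ μ Q)
    orthogonal⇔slopes L L′ L∦Y L′∦Y = mk⇔
      (λ ⟂ → to (trans (sym inner≈) ⟂))
      (λ slopes → trans inner≈ (from slopes))
      where
      open Equivalence (-y+x≈0⇔x≈y (t L * t L′) (μ Q))
      inner≈ : inner Q (u L , t L) (u L′ , t L′) ≈ - μ Q + t L * t L′
      inner≈ = inner-non-vertical L L′ (¬Parallel-Y-axis⇒u≈1 L L∦Y) (¬Parallel-Y-axis⇒u≈1 L′ L′∦Y)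

lemma4p3 : ∀ {c ℓ} (F : Field c ℓ) → let open Field F in let open FieldDefs F in
    CharNot2 → (Q : Quadrilateral) → StandardForm Q →
    (Φ Q ≈Φ Y²-mX² (μ Q))
    × (∀ (L L′ : Line) →
         ¬ Parallel L X-axis → ¬ Parallel L Y-axis →
         ¬ Parallel L′ X-axis → ¬ Parallel L′ Y-axis →
         (Orthogonal Q L L′ ⇔ (slope L * slope L′ ≈ μ Q)))
-- The characteristic hypothesis is not needed: the coefficient 2β of XY vanishes outright.
lemma4p3 F _ Q ((tA≈0 , uA≈1 , _) , (tA′≈1 , uA′≈0 , _)) =
  Φ≈Y²-μX² , λ L L′ _ L∦Y _ L′∦Y → orthogonal⇔slopes L L′ L∦Y L′∦Y
  where open QuadrilateralLemmas.InStandardForm F Q tA≈0 uA≈1 tA′≈1 uA′≈0
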